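{- Let $S\in\mathcal{S}$ be a superblock, let $J_S\subseteq J$ be the set of jobs spanning $S$, and for $j\in J_S$ let $y^*_{j,S}=\sum_{B\in\mathcal{B}(S)}\sum_{C\in\mathcal{C}(B):j\in J_C}x^*_C$. Then there exists a partition $J_1,\dots,J_{1/\varepsilon}$ of $J_S$ (parts possibly empty) such that (C1) for each $\ell\in[1/\varepsilon-1]$, each $j\in J_\ell$ and each $j'\in J_{\ell+1}$ we have $p_j\ge p_{j'}$; (C2) for each $\ell\in[1/\varepsilon]$ we have $\varepsilon\sum_{j\in J_S}y^*_{j,S}-1\le\sum_{j\in J_\ell}y^*_{j,S}\le1+\varepsilon\sum_{j\in J_S}y^*_{j,S}$.
   Context: Throughput Maximization (single machine): jobs $J$, each $j$ with processing time $p_j$, release time $r_j$, deadline $d_j$ (natural numbers), time window $\mathrm{tw}(j)=[r_j,d_j)$; $T=\max_jd_j$; $\varepsilon>0$ with $1/\varepsilon\in\mathbb{N}$; $[k]=\{1,\dots,k\}$. A block is $[a,b)$, $a<b$. A block-superblock partition $(\mathcal{B},\mathcal{S})$: two partitions of $[0,T)$ into blocks, each superblock $S\in\mathcal{S}$ the union of a set $\mathcal{B}(S)$ of consecutive blocks of $\mathcal{B}$. $B_{j,L}$: block containing $r_j$; $B_{j,R}=[s,t)$: block with $d_j\in(s,t]$; $j$ spans $S$ if $S\subseteq\mathrm{tw}(j)$. For a given $K$, a configuration $C=(B_C,J_C)$: a block $B_C\in\mathcal{B}$ and $J_C\subseteq J$ with $|J_C|\le K$, each $j\in J_C$ having $B_C\in\{B_{j,L},B_{j,R}\}$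 or $B_C$ inside a superblock spanned by $j$, such that $J_C$ can be feasibly scheduled (start times $s(j)$, $[s(j),s(j)+p_j)\subseteq\mathrm{tw}(j)\cap B_C$, pairwise disjoint). $\mathcal{C}(B)$: configurations with block $B$, $\mathcal{C}=\bigcup_B\mathcal{C}(B)$. $(x^*_C)_{C\in\mathcal{C}}$ is an optimal solution of the configuration LP: maximize $\sum_C|J_C|x_C$ s.t. $\sum_{C:j\in J_C}x_C\le1$ ($j\in J$), $\sum_{C\in\mathcal{C}(B)}x_C=1$ ($B\in\mathcal{B}$), $x\ge0$. -}

module Defs where

open import Data.Nat as ℕ using (ℕ; zero; suc; _≤ᵇ_; _⊔_; NonZero)
open import Data.Fin using (Fin; zero; suc; toℕ; inject₁; fromℕ)
open import Data.Fin.Subset using (Subset; inside; outside; ∣_∣; _∈_)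
open import Data.Vec using (Vec; []; _∷_; lookup)
open import Data.Bool using (Bool; true; false; if_then_else_; _∧_; T)
open import Data.Integer using (+_)
open import Data.Rational using (ℚ; 0ℚ; 1ℚ; _+_; _*_; _-_; _≤_; _/_)
open import Data.Product using (Σ; _×_; ∃)
open import Data.Sum using (_⊎_)
open import Data.Empty using (⊥)
open import Relation.Binary.PropositionalEquality using (_≡_; _≢_)

Σᶠ : {n : ℕ} → (Fin n → ℚ) → ℚ
Σᶠ {zero}  f = 0ℚ
Σᶠ {suc n} f = f zero + Σᶠ (λ i → f (suc i))

Σˢ : {n : ℕ} → (Subset n → ℚ) → ℚ
Σˢ {zero}  f = f []
Σˢ {suc n} f = Σˢ (λ s → f (inside ∷ s)) + Σˢ (λ s → f (outside ∷ s))

ℕ→ℚ : ℕ → ℚ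
ℕ→ℚ k = (+ k) / 1

record Jobs (n : ℕ) : Set where
  field
    p r d : Fin n → ℕ

horizon : {n : ℕ} → Jobs n → ℕ
horizon {zero}  J = 0
horizon {suc n} J = Jobs.d J zero ⊔ horizon record
  { p = λ i → Jobs.p J (suc i) ; r = λ i → Jobs.r J (suc i) ; d = λ i → Jobs.d J (suc i) }

-- Block partition of [0,T): boundaries 0 = b 0 < b 1 < ... < b m = T;
-- block i : Fin m is [b i, b (i+1)).

record BlockPartition (T : ℕ) : Set where
  field
    m      : ℕ
    b      : Fin (suc m) → ℕ
    b-incr : (i : Fin m) → b (inject₁ i) ℕ.< b (suc i)
    b-zero : b zero ≡ 0
    b-last : b (fromℕ m) ≡ T

  lo hi : Fin m → ℕ
  lo i = b (inject₁ i)
  hi i = b (suc i)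

-- Superblock partition: superblock boundaries are a subsequence
-- c 0 = 0 < c 1 < ... < c k = m of the block-boundary indices;
-- superblock q : Fin k is the union of blocks i with c q ≤ i < c (q+1),
-- i.e. the interval [b (c q), b (c (q+1))).

record SuperPartition {T : ℕ} (BP : BlockPartition T) : Set where
  open BlockPartition BP
  field
    k      : ℕ
    c      : Fin (suc k) → Fin (suc m)
    c-incr : (q : Fin k) → toℕ (c (inject₁ q)) ℕ.< toℕ (c (suc q))
    c-zero : c zero ≡ zero
    c-last : c (fromℕ k) ≡ fromℕ m

  sLo sHi : Fin k → ℕ
  sLo q = b (c (inject₁ q))
  sHi q = b (c (suc q))

  inSuperᵇ : Fin m → Fin k → Bool
  inSuperᵇ i q = (toℕ (c (inject₁ q)) ≤ᵇ toℕ i) ∧ (suc (toℕ i) ≤ᵇ toℕ (c (suc q)))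

module Setting {n : ℕ} (JB : Jobs n) (K : ℕ)
               (BP : BlockPartition (horizon JB))
               (SP : SuperPartition BP) where
  open Jobs JB
  open BlockPartition BP
  open SuperPartition SP

  spansᵇ : Fin n → Fin k → Bool
  spansᵇ j q = (r j ≤ᵇ sLo q) ∧ (sHi q ≤ᵇ d j)

  IsBL : Fin m → Fin n → Set
  IsBL i j = lo i ℕ.≤ r j × r j ℕ.< hi i

  IsBR : Fin m → Fin n → Set
  IsBR i j = lo i ℕ.< d j × d j ℕ.≤ hi i

  Allowed : Fin m → Fin n → Set
  Allowed i j = IsBL i j ⊎ IsBR i j
              ⊎ Σ (Fin k) (λ q → T (inSuperᵇ i q) × T (spansᵇ j q))

  Schedulable : Fin m → Subset n → Set
  Schedulable i s = Σ (Fin n → ℕ) λ st →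
      ((j : Fin n) → j ∈ s → (t : ℕ) → st j ℕ.≤ t → t ℕ.< st j ℕ.+ p j →
          (r j ℕ.≤ t × t ℕ.< d j) × (lo i ℕ.≤ t × t ℕ.< hi i))
    × ((j j' : Fin n) → j ∈ s → j' ∈ s → j ≢ j' → (t : ℕ) →
          st j ℕ.≤ t → t ℕ.< st j ℕ.+ p j →
          st j' ℕ.≤ t → t ℕ.< st j' ℕ.+ p j' → ⊥)

  IsConfig : Fin m → Subset n → Set
  IsConfig i s = (∣ s ∣ ℕ.≤ K)
               × ((j : Fin n) → j ∈ s → Allowed i j)
               × Schedulable i s

  [_∈_]· : Fin n → Subset n → ℚ → ℚ
  [ j ∈ s ]· v = if lookup s j then v else 0ℚ

  -- LP variables: one value for each pair (block, job set); the LP over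
  -- configurations corresponds to those vectors vanishing off configurations.
  Vars : Set
  Vars = Fin m → Subset n → ℚ

  Feasible : Vars → Set
  Feasible x = ((i : Fin m) (s : Subset n) → 0ℚ ≤ x i s)
             × ((i : Fin m) (s : Subset n) → (IsConfig i s → ⊥) → x i s ≡ 0ℚ)
             × ((j : Fin n) → Σᶠ (λ i → Σˢ (λ s → [ j ∈ s ]· (x i s))) ≤ 1ℚ)
             × ((i : Fin m) → Σˢ (λ s → x i s) ≡ 1ℚ)

  objective : Vars → ℚ
  objective x = Σᶠ (λ i → Σˢ (λ s → ℕ→ℚ ∣ s ∣ * x i s))

  Optimal : Vars → Set
  Optimal x = Feasible x × ((x' : Vars) → Feasible x' → objective x' ≤ objective x)

  y : Vars → Fin n → Fin k → ℚ
  y x j q = Σᶠ (λ i → if inSuperᵇ i q then Σˢ (λ s → [ j ∈ s ]· (x i s)) else 0ℚ)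

  Ytot : Vars → Fin k → ℚ
  Ytot x q = Σᶠ (λ j → if spansᵇ j q then y x j q else 0ℚ)

module Submission where

-- Lay the jobs out on a line in order of non-increasing processing time, job j
-- occupying an interval of length w j = y*_{j,S} ≤ 1 (zero for jobs not spanning S)
-- that starts at the mass of the jobs before it, and cut [0, Y) at the points ℓ·Y/L.
-- A job joins the piece in which its interval starts.  Only one job can straddle a
-- cut, so the jobs starting before a cut t ≤ Y carry mass between t and t + 1; the
-- mass of a piece is the difference of two such masses at consecutive cuts, hence
-- lies within 1 of Y/L.  Piece indices are monotone along the line, which gives (C1).

open import Defs
open import Data.Nat using (ℕ; suc; NonZero)
open import Data.Fin using (Fin; toℕ)
open import Data.Bool using (T; if_then_else_; _∧_)
open import Data.Integer using (+_)
open import Data.Rational using (ℚ; 0ℚ; 1ℚ; _+_; _*_; _-_; _≤_; _/_)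
open import Data.Product using (Σ; _×_)
open import Relation.Binary.PropositionalEquality using (_≡_)

open import Data.Bool using (Bool; true; false)
open import Data.Empty using (⊥-elim)
open import Data.Fin using (zero; suc; fromℕ<)
import Data.Fin.Properties as Finₚ
open import Data.Fin.Subset using (Subset; inside; outside)
open import Data.Vec using ([]; _∷_; lookup)
import Data.Integer as ℤ
import Data.Integer.Properties as ℤₚ
import Data.Nat as ℕ
open import Data.Nat using (zero; z≤n; s≤s; _<ᵇ_; _≡ᵇ_)
import Data.Nat.Coprimality as Coprime
import Data.Nat.Properties as ℕₚ
open import Data.Product using (_,_; ∃-syntax)
open import Data.Rational using (_<_; mkℚ)
import Data.Rational.Properties as ℚₚ
open import Data.Rational.Solver using (module +-*-Solver)
open import Data.Sum using (_⊎_; inj₁; inj₂; [_,_]′)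
open import Function using (Injective; _on_; _∘_; id; mk⇔; _⇔_)
open import Relation.Binary using (Rel; Total; Transitive; tri<; tri≈; tri>)
open import Relation.Binary.PropositionalEquality using (refl; sym; trans; cong; cong₂; subst; subst₂; _≢_; module ≡-Reasoning)
open import Relation.Nullary using (¬_; Dec; yes; no; does)
open import Relation.Nullary.Decidable using (dec-true; dec-false; does-⇔; decidable-stable; ¬?)
open import Relation.Unary using (Pred; Decidable)

open +-*-Solver

[_]·_ : Bool → ℚ → ℚ
[ b ]· v = if b then v else 0ℚ

[]·-nonNeg : ∀ b {v} → 0ℚ ≤ v → 0ℚ ≤ [ b ]· v
[]·-nonNeg true  0≤v = 0≤v
[]·-nonNeg false _   = ℚₚ.≤-refl

[]·-≤ : ∀ b {v} → 0ℚ ≤ v → [ b ]· v ≤ v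
[]·-≤ true  _   = ℚₚ.≤-refl
[]·-≤ false 0≤v = 0≤v

[]·-mono : ∀ {a b} {A : Set a} {B : Set b} (a? : Dec A) (b? : Dec B) {v} →
           (A → B) → 0ℚ ≤ v → [ does a? ]· v ≤ [ does b? ]· v
[]·-mono (yes _) (yes _) _   _   = ℚₚ.≤-refl
[]·-mono (yes a) (no ¬b) A→B _   = ⊥-elim (¬b (A→B a))
[]·-mono (no _)  b?      _   0≤v = []·-nonNeg (does b?) 0≤v

[]·-∧ : ∀ b c v → [ b ∧ c ]· v ≡ [ c ]· [ b ]· v
[]·-∧ true  c     v = refl
[]·-∧ false true  v = refl
[]·-∧ false false v = refl

[]·-<ᵇ-suc : ∀ g ℓ v → [ g <ᵇ suc ℓ ]· v ≡ [ g ≡ᵇ ℓ ]· v + [ g <ᵇ ℓ ]· v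
[]·-<ᵇ-suc zero    zero    v = sym (ℚₚ.+-identityʳ v)
[]·-<ᵇ-suc zero    (suc ℓ) v = sym (ℚₚ.+-identityˡ v)
[]·-<ᵇ-suc (suc g) zero    v = refl
[]·-<ᵇ-suc (suc g) (suc ℓ) v = []·-<ᵇ-suc g ℓ v

Σᶠ-cong : ∀ {n} {f g : Fin n → ℚ} → (∀ i → f i ≡ g i) → Σᶠ f ≡ Σᶠ g
Σᶠ-cong {zero}  _   = refl
Σᶠ-cong {suc n} f≗g = cong₂ _+_ (f≗g zero) (Σᶠ-cong (f≗g ∘ suc))

Σᶠ-mono : ∀ {n} {f g : Fin n → ℚ} → (∀ i → f i ≤ g i) → Σᶠ f ≤ Σᶠ g
Σᶠ-mono {zero}  _   = ℚₚ.≤-refl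
Σᶠ-mono {suc n} f≤g = ℚₚ.+-mono-≤ (f≤g zero) (Σᶠ-mono (f≤g ∘ suc))

Σᶠ-zero : ∀ n → Σᶠ {n} (λ _ → 0ℚ) ≡ 0ℚ
Σᶠ-zero zero    = refl
Σᶠ-zero (suc n) = cong (_+_ 0ℚ) (Σᶠ-zero n)

Σᶠ-nonNeg : ∀ {n} {f : Fin n → ℚ} → (∀ i → 0ℚ ≤ f i) → 0ℚ ≤ Σᶠ f
Σᶠ-nonNeg {n} {f} 0≤f = subst (_≤ Σᶠ f) (Σᶠ-zero n) (Σᶠ-mono 0≤f)

Σᶠ-distrib-+ : ∀ {n} (f g : Fin n → ℚ) → Σᶠ (λ i → f i + g i) ≡ Σᶠ f + Σᶠ g
Σᶠ-distrib-+ {zero}  f g = refl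
Σᶠ-distrib-+ {suc n} f g = begin
  (f zero + g zero) + Σᶠ (λ i → f (suc i) + g (suc i)) ≡⟨ cong (_+_ (f zero + g zero)) (Σᶠ-distrib-+ (f ∘ suc) (g ∘ suc)) ⟩
  (f zero + g zero) + (Σᶠ (f ∘ suc) + Σᶠ (g ∘ suc))    ≡⟨ solve 4 (λ a b c d → (a :+ b) :+ (c :+ d) := (a :+ c) :+ (b :+ d))
                                                                  refl (f zero) (g zero) (Σᶠ (f ∘ suc)) (Σᶠ (g ∘ suc)) ⟩
  (f zero + Σᶠ (f ∘ suc)) + (g zero + Σᶠ (g ∘ suc))    ∎
  where open ≡-Reasoning

Σᶠ-except : ∀ {n} {f g : Fin n → ℚ} (m : Fin n) →
            (∀ i → i ≢ m → f i ≡ g i) → g m ≡ 0ℚ → Σᶠ f ≡ Σᶠ g + f m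
Σᶠ-except {suc n} {f} {g} zero f≗g gm≡0 = begin
  f zero + Σᶠ (f ∘ suc)            ≡⟨ cong (_+_ (f zero)) (Σᶠ-cong (λ i → f≗g (suc i) λ ())) ⟩
  f zero + Σᶠ (g ∘ suc)            ≡⟨ ℚₚ.+-comm (f zero) _ ⟩
  Σᶠ (g ∘ suc) + f zero            ≡⟨ cong (_+ f zero) (sym (trans (cong (_+ Σᶠ (g ∘ suc)) gm≡0)
                                                                 (ℚₚ.+-identityˡ (Σᶠ (g ∘ suc))))) ⟩
  (g zero + Σᶠ (g ∘ suc)) + f zero ∎
  where open ≡-Reasoning
Σᶠ-except {suc n} {f} {g} (suc m) f≗g gm≡0 = begin
  f zero + Σᶠ (f ∘ suc)                 ≡⟨ cong₂ _+_ (f≗g zero λ ())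
                                                       (Σᶠ-except m (λ i i≢m → f≗g (suc i) (i≢m ∘ Finₚ.suc-injective)) gm≡0) ⟩
  g zero + (Σᶠ (g ∘ suc) + f (suc m))   ≡⟨ sym (ℚₚ.+-assoc (g zero) _ _) ⟩
  (g zero + Σᶠ (g ∘ suc)) + f (suc m)   ∎
  where open ≡-Reasoning

Σˢ-nonNeg : ∀ {n} {f : Subset n → ℚ} → (∀ s → 0ℚ ≤ f s) → 0ℚ ≤ Σˢ f
Σˢ-nonNeg {zero}  0≤f = 0≤f []
Σˢ-nonNeg {suc n} 0≤f = ℚₚ.+-mono-≤ (Σˢ-nonNeg (0≤f ∘ (inside ∷_))) (Σˢ-nonNeg (0≤f ∘ (outside ∷_)))

empty⊎least : ∀ {n r p} (_≼_ : Rel (Fin n) r) {Q : Pred (Fin n) p} →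
        Total _≼_ → Transitive _≼_ → Decidable Q →
        (∀ i → ¬ Q i) ⊎ ∃[ m ] Q m × (∀ i → Q i → m ≼ i)
empty⊎least {zero}  _≼_ _     _      _  = inj₁ λ ()
empty⊎least {suc n} _≼_ total ≼-trans Q?
  with empty⊎least (λ i j → suc i ≼ suc j) (λ i j → total (suc i) (suc j)) ≼-trans (Q? ∘ suc) | Q? zero
... | inj₁ none         | no ¬q₀ = inj₁ λ { zero → ¬q₀ ; (suc i) → none i }
... | inj₁ none         | yes q₀ = inj₂ (zero , q₀ , λ { zero _ → [ id , id ]′ (total zero zero) ; (suc i) qᵢ → ⊥-elim (none i qᵢ) })
... | inj₂ (m , qₘ , m≼) | no ¬q₀ = inj₂ (suc m , qₘ , λ { zero q₀ → ⊥-elim (¬q₀ q₀) ; (suc i) qᵢ → m≼ i qᵢ })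
... | inj₂ (m , qₘ , m≼) | yes q₀ with total zero (suc m)
...   | inj₁ 0≼m = inj₂ (zero , q₀ , λ { zero _ → [ id , id ]′ (total zero zero) ; (suc i) qᵢ → ≼-trans 0≼m (m≼ i qᵢ) })
...   | inj₂ m≼0 = inj₂ (suc m , qₘ , λ { zero _ → m≼0 ; (suc i) qᵢ → m≼ i qᵢ })

*+toℕ-monoˡ-< : ∀ {n a b} (i j : Fin n) → a ℕ.< b → a ℕ.* n ℕ.+ toℕ i ℕ.< b ℕ.* n ℕ.+ toℕ j
*+toℕ-monoˡ-< {n} {a} {b} i j a<b = begin-strict
  a ℕ.* n ℕ.+ toℕ i  <⟨ ℕₚ.+-monoʳ-< (a ℕ.* n) (Finₚ.toℕ<n i) ⟩
  a ℕ.* n ℕ.+ n      ≡⟨ ℕₚ.+-comm (a ℕ.* n) n ⟩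
  suc a ℕ.* n        ≤⟨ ℕₚ.*-monoˡ-≤ n a<b ⟩
  b ℕ.* n            ≤⟨ ℕₚ.m≤m+n (b ℕ.* n) (toℕ j) ⟩
  b ℕ.* n ℕ.+ toℕ j  ∎
  where open ℕₚ.≤-Reasoning

*+toℕ-injectiveʳ : ∀ {n a b} (i j : Fin n) → a ℕ.* n ℕ.+ toℕ i ≡ b ℕ.* n ℕ.+ toℕ j → i ≡ j
*+toℕ-injectiveʳ {n} {a} {b} i j eq with ℕₚ.<-cmp a b
... | tri< a<b _ _    = ⊥-elim (ℕₚ.<-irrefl eq (*+toℕ-monoˡ-< i j a<b))
... | tri> _ _ b<a    = ⊥-elim (ℕₚ.<-irrefl (sym eq) (*+toℕ-monoˡ-< j i b<a))
... | tri≈ _ refl _   = Finₚ.toℕ-injective (ℕₚ.+-cancelˡ-≡ (a ℕ.* n) _ _ eq)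

ℕ→ℚ-coprime : ∀ m → ℕ→ℚ m ≡ mkℚ (+ m) 0 (Coprime.sym (Coprime.1-coprimeTo m))
ℕ→ℚ-coprime m = ℚₚ.normalize-coprime (Coprime.sym (Coprime.1-coprimeTo m))

ℕ→ℚ-suc : ∀ m → ℕ→ℚ (suc m) ≡ 1ℚ + ℕ→ℚ m
ℕ→ℚ-suc m rewrite ℕ→ℚ-coprime m = ℚₚ./-cong (cong (ℤ._+_ (+ 1)) (sym (ℤₚ.*-identityʳ (+ m)))) refl

ℕ→ℚ-*-inverse : ∀ k → ℕ→ℚ (suc k) * (+ 1 / suc k) ≡ 1ℚ
ℕ→ℚ-*-inverse k rewrite ℕ→ℚ-coprime (suc k) | ℚₚ.normalize-coprime {1} {k} (Coprime.1-coprimeTo (suc k)) =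
  ℚₚ.*-inverseʳ (mkℚ (+ suc k) 0 (Coprime.sym (Coprime.1-coprimeTo (suc k))))

p≤p+1 : ∀ p → p ≤ p + 1ℚ
p≤p+1 p = subst (_≤ p + 1ℚ) (ℚₚ.+-identityʳ p) (ℚₚ.+-monoʳ-≤ p (ℚₚ.nonNegative⁻¹ 1ℚ))

difference-bounds : ∀ {a e A B G} → a ≤ A × A ≤ a + 1ℚ → a + e ≤ B × B ≤ a + e + 1ℚ → B ≡ G + A →
                    e - 1ℚ ≤ G × G ≤ 1ℚ + e
difference-bounds {a} {e} {A} {B} {G} (a≤A , A≤a+1) (a+e≤B , B≤a+e+1) B≡G+A = lower , upper
  where
  open ℚₚ.≤-Reasoning
  G≡B-A : G ≡ B - A
  G≡B-A = trans (solve 2 (λ G A → G := (G :+ A) :- A) refl G A) (cong (_- A) (sym B≡G+A))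
  lower : e - 1ℚ ≤ G
  lower = begin
    e - 1ℚ             ≡⟨ solve 2 (λ a e → e :- con 1ℚ := (a :+ e) :- (a :+ con 1ℚ)) refl a e ⟩
    (a + e) - (a + 1ℚ) ≤⟨ ℚₚ.+-mono-≤ a+e≤B (ℚₚ.neg-antimono-≤ A≤a+1) ⟩
    B - A              ≡⟨ sym G≡B-A ⟩
    G                  ∎
  upper : G ≤ 1ℚ + e
  upper = begin
    G                  ≡⟨ G≡B-A ⟩
    B - A              ≤⟨ ℚₚ.+-mono-≤ B≤a+e+1 (ℚₚ.neg-antimono-≤ a≤A) ⟩
    (a + e + 1ℚ) - a   ≡⟨ solve 2 (λ a e → (a :+ e :+ con 1ℚ) :- a := con 1ℚ :+ e) refl a e ⟩
    1ℚ + e             ∎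

module GreedySplit {n : ℕ} (rank : Fin n → ℕ) (rank-injective : Injective _≡_ _≡_ rank)
                   (w : Fin n → ℚ) (0≤w : ∀ j → 0ℚ ≤ w j) (w≤1 : ∀ j → w j ≤ 1ℚ) (k : ℕ) where

  totalMass : ℚ
  totalMass = Σᶠ w

  massBefore : Fin n → ℚ
  massBefore j = Σᶠ (λ i → [ does (rank j ℕₚ.<? rank i) ]· w i)

  massStartingBefore : ℚ → ℚ
  massStartingBefore t = Σᶠ (λ j → [ does (massBefore j ℚₚ.<? t) ]· w j)

  massBefore-nonNeg : ∀ j → 0ℚ ≤ massBefore j
  massBefore-nonNeg j = Σᶠ-nonNeg (λ i → []·-nonNeg _ (0≤w i))

  massBefore-antitone : ∀ {j j'} → rank j ℕ.≤ rank j' → massBefore j' ≤ massBefore j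
  massBefore-antitone {j} {j'} j≤j' =
    Σᶠ-mono (λ i → []·-mono (rank j' ℕₚ.<? rank i) (rank j ℕₚ.<? rank i) (ℕₚ.≤-<-trans j≤j') (0≤w i))

  massStartingBefore-≤ : ∀ {t} → 0ℚ ≤ t → massStartingBefore t ≤ t + 1ℚ
  massStartingBefore-≤ {t} 0≤t
    with empty⊎least (ℕ._≤_ on rank) (λ i j → ℕₚ.≤-total (rank i) (rank j)) ℕₚ.≤-trans (λ j → massBefore j ℚₚ.<? t)
  ... | inj₁ none = begin
    massStartingBefore t ≡⟨ Σᶠ-cong (λ j → cong ([_]· w j) (dec-false (massBefore j ℚₚ.<? t) (none j))) ⟩
    Σᶠ {n} (λ _ → 0ℚ)    ≡⟨ Σᶠ-zero n ⟩
    0ℚ                   ≤⟨ ℚₚ.+-mono-≤ 0≤t (ℚₚ.nonNegative⁻¹ 1ℚ) ⟩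
    t + 1ℚ               ∎
    where open ℚₚ.≤-Reasoning
  ... | inj₂ (m , m-starts-before , m-first) = begin
    massStartingBefore t                                  ≡⟨ Σᶠ-except m same m-not-after-m ⟩
    massBefore m + [ does (massBefore m ℚₚ.<? t) ]· w m   ≤⟨ ℚₚ.+-mono-≤ (ℚₚ.<⇒≤ m-starts-before)
                                                                          (ℚₚ.≤-trans ([]·-≤ _ (0≤w m)) (w≤1 m)) ⟩
    t + 1ℚ                                                ∎
    where
    open ℚₚ.≤-Reasoning
    m-not-after-m : [ does (rank m ℕₚ.<? rank m) ]· w m ≡ 0ℚ
    m-not-after-m = cong ([_]· w m) (dec-false (rank m ℕₚ.<? rank m) (ℕₚ.n≮n (rank m)))
    same : ∀ i → i ≢ m → [ does (massBefore i ℚₚ.<? t) ]· w i ≡ [ does (rank m ℕₚ.<? rank i) ]· w i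
    same i i≢m = cong ([_]· w i) (does-⇔ (mk⇔ to from) (massBefore i ℚₚ.<? t) (rank m ℕₚ.<? rank i))
      where
      to : massBefore i < t → rank m ℕ.< rank i
      to i-starts-before = ℕₚ.≤∧≢⇒< (m-first i i-starts-before) (i≢m ∘ sym ∘ rank-injective)
      from : rank m ℕ.< rank i → massBefore i < t
      from m<i = ℚₚ.≤-<-trans (massBefore-antitone (ℕₚ.<⇒≤ m<i)) m-starts-before

  ≤-massStartingBefore : ∀ {t} → t ≤ totalMass → t ≤ massStartingBefore t
  ≤-massStartingBefore {t} t≤total
    with empty⊎least (ℕ._≥_ on rank) (λ i j → ℕₚ.≤-total (rank j) (rank i)) (λ i≥j j≥l → ℕₚ.≤-trans j≥l i≥j)
               (λ j → ¬? (massBefore j ℚₚ.<? t))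
  ... | inj₁ none = begin
    t                    ≤⟨ t≤total ⟩
    totalMass            ≡⟨ Σᶠ-cong (λ j → cong ([_]· w j) (sym (dec-true (massBefore j ℚₚ.<? t)
                                                   (decidable-stable (massBefore j ℚₚ.<? t) (none j))))) ⟩
    massStartingBefore t ∎
    where open ℚₚ.≤-Reasoning
  ... | inj₂ (m , m-not-before , m-last) = begin
    t                    ≤⟨ ℚₚ.≮⇒≥ m-not-before ⟩
    massBefore m         ≡⟨ Σᶠ-cong same ⟩
    massStartingBefore t ∎
    where
    open ℚₚ.≤-Reasoning
    same : ∀ i → [ does (rank m ℕₚ.<? rank i) ]· w i ≡ [ does (massBefore i ℚₚ.<? t) ]· w i
    same i = cong ([_]· w i) (does-⇔ (mk⇔ to from) (rank m ℕₚ.<? rank i) (massBefore i ℚₚ.<? t))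
      where
      to : rank m ℕ.< rank i → massBefore i < t
      to m<i = decidable-stable (massBefore i ℚₚ.<? t) (λ i-not-before → ℕₚ.<⇒≱ m<i (m-last i i-not-before))
      from : massBefore i < t → rank m ℕ.< rank i
      from i-before = ℕₚ.≰⇒> (λ i≤m → m-not-before (ℚₚ.≤-<-trans (massBefore-antitone i≤m) i-before))

  share : ℚ
  share = (+ 1 / suc k) * totalMass

  share-nonNeg : 0ℚ ≤ share
  share-nonNeg = subst (_≤ share) (ℚₚ.*-zeroʳ (+ 1 / suc k))
    (ℚₚ.*-monoˡ-≤-nonNeg (+ 1 / suc k) {{ℚₚ.normalize-nonNeg 1 (suc k)}} (Σᶠ-nonNeg 0≤w))

  threshold : ℕ → ℚ
  threshold zero    = 0ℚ
  threshold (suc ℓ) = threshold ℓ + share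

  threshold-mono : ∀ {ℓ ℓ'} → ℓ ℕ.≤ ℓ' → threshold ℓ ≤ threshold ℓ'
  threshold-mono {ℓ' = zero}   z≤n         = ℚₚ.≤-refl
  threshold-mono {ℓ' = suc ℓ'} z≤n         = ℚₚ.+-mono-≤ (threshold-mono {ℓ' = ℓ'} z≤n) share-nonNeg
  threshold-mono               (s≤s ℓ≤ℓ') = ℚₚ.+-monoˡ-≤ share (threshold-mono ℓ≤ℓ')

  threshold-nonNeg : ∀ ℓ → 0ℚ ≤ threshold ℓ
  threshold-nonNeg ℓ = threshold-mono {zero} {ℓ} z≤n

  threshold≡*share : ∀ ℓ → threshold ℓ ≡ ℕ→ℚ ℓ * share
  threshold≡*share zero    = sym (ℚₚ.*-zeroˡ share)
  threshold≡*share (suc ℓ) = begin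
    threshold ℓ + share     ≡⟨ cong (λ z → z + share) (threshold≡*share ℓ) ⟩
    ℕ→ℚ ℓ * share + share   ≡⟨ solve 2 (λ x s → x :* s :+ s := (con 1ℚ :+ x) :* s) refl (ℕ→ℚ ℓ) share ⟩
    (1ℚ + ℕ→ℚ ℓ) * share    ≡⟨ cong (_* share) (sym (ℕ→ℚ-suc ℓ)) ⟩
    ℕ→ℚ (suc ℓ) * share     ∎
    where open ≡-Reasoning

  threshold-last : threshold (suc k) ≡ totalMass
  threshold-last = begin
    threshold (suc k)                              ≡⟨ threshold≡*share (suc k) ⟩
    ℕ→ℚ (suc k) * ((+ 1 / suc k) * totalMass)      ≡⟨ sym (ℚₚ.*-assoc (ℕ→ℚ (suc k)) _ totalMass) ⟩
    (ℕ→ℚ (suc k) * (+ 1 / suc k)) * totalMass      ≡⟨ cong (_* totalMass) (ℕ→ℚ-*-inverse k) ⟩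
    1ℚ * totalMass                                 ≡⟨ ℚₚ.*-identityˡ totalMass ⟩
    totalMass                                      ∎
    where open ≡-Reasoning

  -- ⌊Q / share⌋ capped at m, computed without dividing by a possibly zero share
  level : ℕ → ℚ → ℕ
  level zero    Q = zero
  level (suc m) Q with threshold (suc m) ℚₚ.≤? Q
  ... | yes _ = suc m
  ... | no  _ = level m Q

  level-≤ : ∀ m Q → level m Q ℕ.≤ m
  level-≤ zero    Q = z≤n
  level-≤ (suc m) Q with threshold (suc m) ℚₚ.≤? Q
  ... | yes _ = ℕₚ.≤-refl
  ... | no  _ = ℕₚ.m≤n⇒m≤1+n (level-≤ m Q)

  threshold-level-≤ : ∀ m {Q} → 0ℚ ≤ Q → threshold (level m Q) ≤ Q
  threshold-level-≤ zero    0≤Q = 0≤Q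
  threshold-level-≤ (suc m) {Q} 0≤Q with threshold (suc m) ℚₚ.≤? Q
  ... | yes threshold≤Q = threshold≤Q
  ... | no  _           = threshold-level-≤ m 0≤Q

  ≤-level : ∀ {ℓ} m {Q} → ℓ ℕ.≤ m → threshold ℓ ≤ Q → ℓ ℕ.≤ level m Q
  ≤-level zero    z≤n _ = z≤n
  ≤-level (suc m) {Q} ℓ≤1+m threshold≤Q with threshold (suc m) ℚₚ.≤? Q
  ... | yes _ = ℓ≤1+m
  ... | no threshold≰Q with ℕₚ.m≤n⇒m<n∨m≡n ℓ≤1+m
  ...   | inj₁ ℓ<1+m = ≤-level m (ℕ.s≤s⁻¹ ℓ<1+m) threshold≤Q
  ...   | inj₂ refl  = ⊥-elim (threshold≰Q threshold≤Q)

  level-mono : ∀ m {Q Q'} → 0ℚ ≤ Q → Q ≤ Q' → level m Q ℕ.≤ level m Q'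
  level-mono m 0≤Q Q≤Q' = ≤-level m (level-≤ m _) (ℚₚ.≤-trans (threshold-level-≤ m 0≤Q) Q≤Q')

  level<⇔<threshold : ∀ {ℓ} m {Q} → ℓ ℕ.≤ m → 0ℚ ≤ Q → (level m Q ℕ.< ℓ ⇔ Q < threshold ℓ)
  level<⇔<threshold m ℓ≤m 0≤Q = mk⇔
    (λ level<ℓ → ℚₚ.≰⇒> (λ threshold≤Q → ℕₚ.<⇒≱ level<ℓ (≤-level m ℓ≤m threshold≤Q)))
    (λ Q<threshold → ℕₚ.≰⇒> (λ ℓ≤level → ℚₚ.<-irrefl refl
      (ℚₚ.<-≤-trans Q<threshold (ℚₚ.≤-trans (threshold-mono ℓ≤level) (threshold-level-≤ m 0≤Q)))))

  group : Fin n → Fin (suc k)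
  group j = fromℕ< (s≤s (level-≤ k (massBefore j)))

  toℕ-group : ∀ j → toℕ (group j) ≡ level k (massBefore j)
  toℕ-group j = Finₚ.toℕ-fromℕ< _

  group-antitone : ∀ {j j'} → rank j ℕ.≤ rank j' → toℕ (group j') ℕ.≤ toℕ (group j)
  group-antitone {j} {j'} j≤j' rewrite toℕ-group j | toℕ-group j' =
    level-mono k (massBefore-nonNeg j') (massBefore-antitone j≤j')

  group<⇔<threshold : ∀ {ℓ} j → ℓ ℕ.≤ k → (toℕ (group j) ℕ.< ℓ ⇔ massBefore j < threshold ℓ)
  group<⇔<threshold j ℓ≤k rewrite toℕ-group j = level<⇔<threshold k ℓ≤k (massBefore-nonNeg j)

  groupMass : ℕ → ℚ
  groupMass ℓ = Σᶠ (λ j → [ toℕ (group j) ≡ᵇ ℓ ]· w j)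

  massBelowGroup : ℕ → ℚ
  massBelowGroup ℓ = Σᶠ (λ j → [ toℕ (group j) <ᵇ ℓ ]· w j)

  massBelowGroup-suc : ∀ ℓ → massBelowGroup (suc ℓ) ≡ groupMass ℓ + massBelowGroup ℓ
  massBelowGroup-suc ℓ = trans (Σᶠ-cong (λ j → []·-<ᵇ-suc (toℕ (group j)) ℓ (w j)))
    (Σᶠ-distrib-+ (λ j → [ toℕ (group j) ≡ᵇ ℓ ]· w j) (λ j → [ toℕ (group j) <ᵇ ℓ ]· w j))

  massBelowGroup≡massStartingBefore : ∀ {ℓ} → ℓ ℕ.≤ k → massBelowGroup ℓ ≡ massStartingBefore (threshold ℓ)
  massBelowGroup≡massStartingBefore {ℓ} ℓ≤k = Σᶠ-cong λ j →
    cong ([_]· w j) (does-⇔ (group<⇔<threshold j ℓ≤k) (toℕ (group j) ℕₚ.<? ℓ) (massBefore j ℚₚ.<? threshold ℓ))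

  massBelowGroup-last : massBelowGroup (suc k) ≡ totalMass
  massBelowGroup-last = Σᶠ-cong λ j → cong ([_]· w j) (dec-true (toℕ (group j) ℕₚ.<? suc k) (Finₚ.toℕ<n (group j)))

  massBelowGroup-bounds : ∀ {ℓ} → ℓ ℕ.≤ suc k →
                          threshold ℓ ≤ massBelowGroup ℓ × massBelowGroup ℓ ≤ threshold ℓ + 1ℚ
  massBelowGroup-bounds {ℓ} ℓ≤1+k with ℕₚ.m≤n⇒m<n∨m≡n ℓ≤1+k
  ... | inj₁ ℓ<1+k = subst (λ M → threshold ℓ ≤ M × M ≤ threshold ℓ + 1ℚ)
          (sym (massBelowGroup≡massStartingBefore (ℕ.s≤s⁻¹ ℓ<1+k)))
          ( ≤-massStartingBefore (ℚₚ.≤-trans (threshold-mono ℓ≤1+k) (ℚₚ.≤-reflexive threshold-last))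
          , massStartingBefore-≤ (threshold-nonNeg ℓ))
  ... | inj₂ refl = subst₂ (λ a M → a ≤ M × M ≤ a + 1ℚ) (sym threshold-last) (sym massBelowGroup-last)
          (ℚₚ.≤-refl , p≤p+1 totalMass)

  groupMass-bounds : ∀ {ℓ} → ℓ ℕ.≤ k → share - 1ℚ ≤ groupMass ℓ × groupMass ℓ ≤ 1ℚ + share
  groupMass-bounds {ℓ} ℓ≤k =
    difference-bounds {threshold ℓ} {share} {massBelowGroup ℓ} {massBelowGroup (suc ℓ)} {groupMass ℓ}
      (massBelowGroup-bounds (ℕₚ.m≤n⇒m≤1+n ℓ≤k)) (massBelowGroup-bounds (s≤s ℓ≤k)) (massBelowGroup-suc ℓ)

module _ {n : ℕ} (JB : Jobs n) (K : ℕ) (BP : BlockPartition (horizon JB)) (SP : SuperPartition BP) where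
  open Setting JB K BP SP using (Feasible; y)
  open SuperPartition SP using (inSuperᵇ)

  y-nonNeg : ∀ {x} → Feasible x → ∀ j q → 0ℚ ≤ y x j q
  y-nonNeg (x-nonNeg , _) j q =
    Σᶠ-nonNeg λ i → []·-nonNeg (inSuperᵇ i q) (Σˢ-nonNeg λ s → []·-nonNeg (lookup s j) (x-nonNeg i s))

  y≤1 : ∀ {x} → Feasible x → ∀ j q → y x j q ≤ 1ℚ
  y≤1 (x-nonNeg , _ , job-capacity , _) j q = ℚₚ.≤-trans
    (Σᶠ-mono λ i → []·-≤ (inSuperᵇ i q) (Σˢ-nonNeg λ s → []·-nonNeg (lookup s j) (x-nonNeg i s)))
    (job-capacity j)

lemma10 : {n : ℕ} (JB : Jobs n) (K : ℕ) (L : ℕ) {{_ : NonZero L}}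
    (BP : BlockPartition (horizon JB)) (SP : SuperPartition BP)
    (x : Setting.Vars JB K BP SP) → Setting.Optimal JB K BP SP x →
    (q : Fin (SuperPartition.k SP)) →
    Σ (Fin n → Fin L) λ part →
      ((j j' : Fin n) → T (Setting.spansᵇ JB K BP SP j q) → T (Setting.spansᵇ JB K BP SP j' q) →
        toℕ (part j') ≡ suc (toℕ (part j)) → Jobs.p JB j' Data.Nat.≤ Jobs.p JB j)
      × ((ℓ : Fin L) →
          (((+ 1 / L) * Setting.Ytot JB K BP SP x q) - 1ℚ
            ≤ Σᶠ (λ j → if Setting.spansᵇ JB K BP SP j q ∧ (toℕ (part j) Data.Nat.≡ᵇ toℕ ℓ) then Setting.y JB K BP SP x j q else 0ℚ))
          × (Σᶠ (λ j → if Setting.spansᵇ JB K BP SP j q ∧ (toℕ (part j) Data.Nat.≡ᵇ toℕ ℓ) then Setting.y JB K BP SP x j q else 0ℚ)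
            ≤ 1ℚ + (+ 1 / L) * Setting.Ytot JB K BP SP x q))
lemma10 {n} JB K (suc k) BP SP x (feasible , _) q = group , sorted , λ ℓ →
    subst (λ G → share - 1ℚ ≤ G × G ≤ 1ℚ + share)
          (sym (Σᶠ-cong λ j → []·-∧ (spansᵇ j q) (toℕ (group j) ≡ᵇ toℕ ℓ) (y x j q)))
          (groupMass-bounds (ℕ.s≤s⁻¹ (Finₚ.toℕ<n ℓ)))
  where
  open Setting JB K BP SP using (spansᵇ; y)
  open Jobs JB using (p)

  rank : Fin n → ℕ
  rank j = p j ℕ.* n ℕ.+ toℕ j

  w : Fin n → ℚ
  w j = [ spansᵇ j q ]· y x j q

  rank-injective : Injective _≡_ _≡_ rank
  rank-injective {i} {j} = *+toℕ-injectiveʳ {a = p i} {b = p j} i j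

  open GreedySplit rank rank-injective w
    (λ j → []·-nonNeg (spansᵇ j q) (y-nonNeg JB K BP SP feasible j q))
    (λ j → ℚₚ.≤-trans ([]·-≤ (spansᵇ j q) (y-nonNeg JB K BP SP feasible j q)) (y≤1 JB K BP SP feasible j q))
    k

  sorted : ∀ j j' → T (spansᵇ j q) → T (spansᵇ j' q) → toℕ (group j') ≡ suc (toℕ (group j)) → p j' ℕ.≤ p j
  sorted j j' _ _ j'-next = ℕₚ.≮⇒≥ λ pj<pj' → ℕₚ.n≮n (toℕ (group j))
    (subst (ℕ._≤ toℕ (group j)) j'-next (group-antitone (ℕₚ.<⇒≤ (*+toℕ-monoˡ-< j j' pj<pj'))))
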